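{- Let $\mathcal{M}=(\mathcal{E},\rho)$ be a $q$-matroid on $\mathcal{E}=\mathbb{F}_q^n$. Then a subspace $X$ is a $q$-flat of $\mathcal{M}$ of rank $r$ if and only if $X^\perp$ is a $q$-cycle of $\mathcal{M}^*$ of nullity $\rho(\mathcal{E})-r$.
   Context: A $q$-matroid is $(\mathcal{E},\rho)$ with $\rho$ from subspaces of $\mathcal{E}$ to $\mathbb{N}_0$, $0\le\rho(X)\le\dim X$, monotone, $\rho(X+Y)+\rho(X\cap Y)\le\rho(X)+\rho(Y)$. A $q$-flat is a subspace $F$ with $\rho(F+\langle e\rangle)>\rho(F)$ for all $e\in\mathcal{E}\setminus F$. $X^\perp$ is the orthogonal complement for the standard dot product. The dual $\mathcal{M}^*=(\mathcal{E},\rho^*)$ has $\rho^*(X)=\dim X+\rho(X^\perp)-\rho(\mathcal{E})$ and nullity $\eta^*(X)=\dim X-\rho^*(X)$; a $q$-cycle of $\mathcal{M}^*$ of nullity $i$ is a subspace minimal with respect to inclusion among subspaces of nullity $i$. -}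

module Defs where

open import Level using (0ℓ)
open import Data.Nat using (ℕ; zero; suc; _∸_; _≤_; _<_) renaming (_+_ to _+ℕ_)
open import Data.Vec using (Vec; []; _∷_; zipWith; replicate; foldr; map)
open import Data.List using (List)
open import Data.List.Membership.Propositional using (_∈_)
open import Data.Product using (Σ; _×_; _,_; ∃)
open import Data.Unit using (⊤; tt)
open import Relation.Nullary using (¬_; Dec; yes; no)
open import Relation.Nullary.Decidable using (_×-dec_)
open import Relation.Binary.PropositionalEquality using (_≡_; _≢_)
open import Relation.Binary.Definitions using (DecidableEquality)
open import Function.Bundles using (_⇔_)
import Algebra.Structures as AS

record FiniteField : Set₁ where
  infixl 6 _+_
  infixl 7 _*_
  field
    Carrier  : Set
    _+_ _*_  : Carrier → Carrier → Carrier
    -_       : Carrier → Carrier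
    0# 1#    : Carrier
    isCommutativeRing : AS.IsCommutativeRing {A = Carrier} _≡_ _+_ _*_ -_ 0# 1#
    0≢1      : 0# ≢ 1#
    inverse  : ∀ x → x ≢ 0# → Σ Carrier (λ y → x * y ≡ 1#)
    _≟_      : DecidableEquality Carrier
    elements : List Carrier
    complete : ∀ x → x ∈ elements

module _ (𝔽 : FiniteField) (n : ℕ) where
  open FiniteField 𝔽

  Vect : Set
  Vect = Vec Carrier n

  zeroV : Vect
  zeroV = replicate n 0#

  _⊕_ : Vect → Vect → Vect
  u ⊕ v = zipWith _+_ u v

  _·_ : Carrier → Vect → Vect
  c · v = map (c *_) v

  dot : Vect → Vect → Carrier
  dot u v = foldr (λ _ → Carrier) _+_ 0# (zipWith _*_ u v)

  -- an F_q-subspace of F_q^n (membership decidable, as every subset of a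
  -- finite set is)
  record Subspace : Set₁ where
    field
      mem   : Vect → Set
      mem?  : ∀ v → Dec (mem v)
      mem-0 : mem zeroV
      mem-+ : ∀ {u v} → mem u → mem v → mem (u ⊕ v)
      mem-· : ∀ c {v} → mem v → mem (c · v)
  open Subspace public

  _⊆_ : Subspace → Subspace → Set
  X ⊆ Y = ∀ v → mem X v → mem Y v

  full : Subspace
  full = record
    { mem = λ _ → ⊤ ; mem? = λ _ → yes tt ; mem-0 = tt
    ; mem-+ = λ _ _ → tt ; mem-· = λ _ _ → tt }

  _∩_ : Subspace → Subspace → Subspace
  X ∩ Y = record
    { mem = λ v → mem X v × mem Y v
    ; mem? = λ v → mem? X v ×-dec mem? Y v
    ; mem-0 = mem-0 X , mem-0 Y
    ; mem-+ = λ { (a , b) (c , d) → mem-+ X a c , mem-+ Y b d }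
    ; mem-· = λ c → λ { (a , b) → mem-· X c a , mem-· Y c b } }

  IsSum : Subspace → Subspace → Subspace → Set
  IsSum X Y S = ∀ v →
    mem S v ⇔ (∃ λ x → ∃ λ y → mem X x × mem Y y × v ≡ x ⊕ y)

  IsSumSpan : Subspace → Vect → Subspace → Set
  IsSumSpan X e S = ∀ v →
    mem S v ⇔ (∃ λ x → ∃ λ c → mem X x × v ≡ x ⊕ (c · e))

  IsPerp : Subspace → Subspace → Set
  IsPerp X Y = ∀ v → mem Y v ⇔ (∀ x → mem X x → dot x v ≡ 0#)

  lincomb : ∀ {d} → Vec Carrier d → Vec Vect d → Vect
  lincomb []       []       = zeroV
  lincomb (c ∷ cs) (b ∷ bs) = (c · b) ⊕ lincomb cs bs

  data AllIn (X : Subspace) : ∀ {d} → Vec Vect d → Set where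
    []  : AllIn X []
    _∷_ : ∀ {d b} {bs : Vec Vect d} → mem X b → AllIn X bs → AllIn X (b ∷ bs)

  IsBasis : Subspace → ∀ {d} → Vec Vect d → Set
  IsBasis X {d} bs =
    AllIn X bs
    × (∀ cs → lincomb cs bs ≡ zeroV → cs ≡ replicate d 0#)
    × (∀ v → mem X v → ∃ λ cs → lincomb cs bs ≡ v)

  IsDim : Subspace → ℕ → Set
  IsDim X d = ∃ λ (bs : Vec Vect d) → IsBasis X bs

  record QMatroid : Set₁ where
    field
      ρ      : Subspace → ℕ
      -- 0 ≤ ρ X is automatic in ℕ
      ρ-dim  : ∀ X d → IsDim X d → ρ X ≤ d
      ρ-mono : ∀ X Y → X ⊆ Y → ρ X ≤ ρ Y
      ρ-sub  : ∀ X Y S → IsSum X Y S → ρ S +ℕ ρ (X ∩ Y) ≤ ρ X +ℕ ρ Y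

  module _ (M : QMatroid) where
    open QMatroid M

    IsFlat : Subspace → Set₁
    IsFlat F = ∀ e → ¬ mem F e → ∀ S → IsSumSpan F e S → ρ F < ρ S

    -- dual rank ρ*(X) = dim X + ρ(X^⊥) − ρ(E), given dim X = d and X^⊥ = Y
    dualRank : ℕ → Subspace → ℕ
    dualRank d Y = (d +ℕ ρ Y) ∸ ρ full

    DualNullity : Subspace → ℕ → Set₁
    DualNullity X i = ∀ d Y → IsDim X d → IsPerp X Y → d ∸ dualRank d Y ≡ i

    IsDualCycle : Subspace → ℕ → Set₁
    IsDualCycle C i =
      DualNullity C i × (∀ Z → Z ⊆ C → DualNullity Z i → C ⊆ Z)

{-# OPTIONS --safe #-}
-- A subspace X is a flat exactly when it is closed: every S ⊇ X with ρ(S) ≤ ρ(X) lies in X.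
-- Orthogonal complementation is an inclusion-reversing involution, and the dual nullity of a
-- subspace Z is ρ(E) − ρ(Z⊥): the truncated difference defining ρ*(Z) is harmless because
-- ρ(E) ≤ dim Z + ρ(Z⊥), as E is spanned by Z⊥ and at most dim Z further vectors, each raising
-- the rank by at most one. Hence the subspaces Z ⊆ X⊥ of dual nullity ρ(E) − ρ(X) are exactly
-- the complements of the subspaces S ⊇ X of rank ρ(X), and minimality of X⊥ among them says
-- that X is closed.
module Submission where

open import Defs
open import Data.Nat using (ℕ; zero; suc; _∸_; _≤_; _<_; z≤n; s≤s) renaming (_+_ to _+ℕ_)
open import Data.Nat.Properties as ℕₚ using ()
open import Data.Vec using (Vec; []; _∷_; head; tail; map; _++_; splitAt)
open import Data.Vec.Properties
  using (zipWith-assoc; zipWith-comm; zipWith-identityˡ; zipWith-identityʳ; ∷-injective; ≡-dec)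
open import Data.List.Membership.Propositional using (find; lose)
open import Data.List.Relation.Unary.Any using (any?)
open import Data.Product using (Σ; _×_; _,_; ∃; proj₁; proj₂)
open import Data.Unit using (tt)
open import Data.Empty using (⊥-elim)
open import Relation.Nullary using (¬_; Dec; yes; no; ¬?)
open import Relation.Nullary.Decidable using (_×-dec_; map′; decidable-stable)
open import Relation.Binary.PropositionalEquality
  using (_≡_; refl; sym; trans; cong; cong₂; subst; module ≡-Reasoning)
open import Function.Base using (id)
open import Function.Bundles using (_⇔_; mk⇔; Equivalence)
open import Level using (0ℓ)
open import Algebra.Bundles using (CommutativeRing)
import Algebra.Properties.CommutativeSemigroup as CommutativeSemigroupProperties
import Algebra.Properties.Ring as RingProperties

module Vectors (𝔽 : FiniteField) where
  open FiniteField 𝔽 renaming (_≟_ to _≟ᶠ_)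
  open ≡-Reasoning

  carrierRing : CommutativeRing 0ℓ 0ℓ
  carrierRing = record { isCommutativeRing = isCommutativeRing }

  open CommutativeRing carrierRing
    using (+-assoc; +-comm; +-identityˡ; +-identityʳ; -‿inverseʳ; *-assoc; *-comm;
           *-identityˡ; *-identityʳ; distribˡ; distribʳ; zeroˡ; zeroʳ)
  open RingProperties (CommutativeRing.ring carrierRing) using (-1*x≈-x; -‿distribˡ-*)
  open CommutativeSemigroupProperties (CommutativeRing.+-commutativeSemigroup carrierRing)
    renaming (interchange to +-interchange)

  V : ℕ → Set
  V k = Vec Carrier k

  infixl 6 _⊞_ _⊟_
  infixr 7 _⊡_

  _⊞_ : ∀ {k} → V k → V k → V k
  _⊞_ = _⊕_ 𝔽 _

  _⊡_ : ∀ {k} → Carrier → V k → V k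
  _⊡_ = _·_ 𝔽 _

  _⊟_ : ∀ {k} → V k → V k → V k
  u ⊟ v = u ⊞ (- 1#) ⊡ v

  𝟎 : ∀ {k} → V k
  𝟎 = zeroV 𝔽 _

  comb : ∀ {k t} → V t → Vec (V k) t → V k
  comb = lincomb 𝔽 _

  ⟨_∣_⟩ : ∀ {k} → V k → V k → Carrier
  ⟨_∣_⟩ = dot 𝔽 _

  ⊞-assoc : ∀ {k} (u v w : V k) → (u ⊞ v) ⊞ w ≡ u ⊞ (v ⊞ w)
  ⊞-assoc = zipWith-assoc +-assoc

  ⊞-comm : ∀ {k} (u v : V k) → u ⊞ v ≡ v ⊞ u
  ⊞-comm = zipWith-comm +-comm

  ⊞-identityˡ : ∀ {k} (v : V k) → 𝟎 ⊞ v ≡ v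
  ⊞-identityˡ = zipWith-identityˡ +-identityˡ

  ⊞-identityʳ : ∀ {k} (v : V k) → v ⊞ 𝟎 ≡ v
  ⊞-identityʳ = zipWith-identityʳ +-identityʳ

  ⊟-self : ∀ {k} (v : V k) → v ⊟ v ≡ 𝟎
  ⊟-self []      = refl
  ⊟-self (x ∷ v) = cong₂ _∷_ (trans (cong (x +_) (-1*x≈-x x)) (-‿inverseʳ x)) (⊟-self v)

  ⊞-interchange : ∀ {k} (a b c d : V k) → (a ⊞ b) ⊞ (c ⊞ d) ≡ (a ⊞ c) ⊞ (b ⊞ d)
  ⊞-interchange []      []      []      []      = refl
  ⊞-interchange (x ∷ a) (y ∷ b) (z ∷ c) (w ∷ d) =
    cong₂ _∷_ (+-interchange x y z w) (⊞-interchange a b c d)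

  [u⊞v]⊟v≡u : ∀ {k} (u v : V k) → (u ⊞ v) ⊟ v ≡ u
  [u⊞v]⊟v≡u u v = begin
    (u ⊞ v) ⊟ v ≡⟨ ⊞-assoc u v _ ⟩
    u ⊞ (v ⊟ v) ≡⟨ cong (u ⊞_) (⊟-self v) ⟩
    u ⊞ 𝟎       ≡⟨ ⊞-identityʳ u ⟩
    u           ∎

  [u⊟v]⊞v≡u : ∀ {k} (u v : V k) → (u ⊟ v) ⊞ v ≡ u
  [u⊟v]⊞v≡u u v = begin
    (u ⊟ v) ⊞ v          ≡⟨ ⊞-assoc u _ v ⟩
    u ⊞ ((- 1#) ⊡ v ⊞ v) ≡⟨ cong (u ⊞_) (trans (⊞-comm _ v) (⊟-self v)) ⟩
    u ⊞ 𝟎                ≡⟨ ⊞-identityʳ u ⟩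
    u                    ∎

  ⊡-distribˡ : ∀ {k} c (u v : V k) → c ⊡ (u ⊞ v) ≡ c ⊡ u ⊞ c ⊡ v
  ⊡-distribˡ c []      []      = refl
  ⊡-distribˡ c (x ∷ u) (y ∷ v) = cong₂ _∷_ (distribˡ c x y) (⊡-distribˡ c u v)

  ⊡-distribʳ : ∀ {k} a b (v : V k) → (a + b) ⊡ v ≡ a ⊡ v ⊞ b ⊡ v
  ⊡-distribʳ a b []      = refl
  ⊡-distribʳ a b (x ∷ v) = cong₂ _∷_ (distribʳ x a b) (⊡-distribʳ a b v)

  ⊡-assoc : ∀ {k} a b (v : V k) → (a * b) ⊡ v ≡ a ⊡ (b ⊡ v)
  ⊡-assoc a b []      = refl
  ⊡-assoc a b (x ∷ v) = cong₂ _∷_ (*-assoc a b x) (⊡-assoc a b v)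

  ⊡-identityˡ : ∀ {k} (v : V k) → 1# ⊡ v ≡ v
  ⊡-identityˡ []      = refl
  ⊡-identityˡ (x ∷ v) = cong₂ _∷_ (*-identityˡ x) (⊡-identityˡ v)

  ⊡-zeroˡ : ∀ {k} (v : V k) → 0# ⊡ v ≡ 𝟎
  ⊡-zeroˡ []      = refl
  ⊡-zeroˡ (x ∷ v) = cong₂ _∷_ (zeroˡ x) (⊡-zeroˡ v)

  ⊡-zeroʳ : ∀ {k} c → c ⊡ 𝟎 {k} ≡ 𝟎
  ⊡-zeroʳ {zero}  c = refl
  ⊡-zeroʳ {suc k} c = cong₂ _∷_ (zeroʳ c) (⊡-zeroʳ c)

  comb-⊞ : ∀ {k t} (a b : V t) (us : Vec (V k) t) → comb (a ⊞ b) us ≡ comb a us ⊞ comb b us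
  comb-⊞ []      []      []       = sym (⊞-identityˡ 𝟎)
  comb-⊞ (x ∷ a) (y ∷ b) (u ∷ us) = begin
    (x + y) ⊡ u ⊞ comb (a ⊞ b) us              ≡⟨ cong₂ _⊞_ (⊡-distribʳ x y u) (comb-⊞ a b us) ⟩
    (x ⊡ u ⊞ y ⊡ u) ⊞ (comb a us ⊞ comb b us) ≡⟨ ⊞-interchange _ _ _ _ ⟩
    (x ⊡ u ⊞ comb a us) ⊞ (y ⊡ u ⊞ comb b us) ∎

  comb-⊡ : ∀ {k t} c (a : V t) (us : Vec (V k) t) → comb (c ⊡ a) us ≡ c ⊡ comb a us
  comb-⊡ c []      []       = sym (⊡-zeroʳ c)
  comb-⊡ c (x ∷ a) (u ∷ us) = begin
    (c * x) ⊡ u ⊞ comb (c ⊡ a) us ≡⟨ cong₂ _⊞_ (⊡-assoc c x u) (comb-⊡ c a us) ⟩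
    c ⊡ (x ⊡ u) ⊞ c ⊡ comb a us   ≡⟨ sym (⊡-distribˡ c _ _) ⟩
    c ⊡ (x ⊡ u ⊞ comb a us)       ∎

  comb-𝟎 : ∀ {k t} (us : Vec (V k) t) → comb 𝟎 us ≡ 𝟎
  comb-𝟎 []       = refl
  comb-𝟎 (u ∷ us) = trans (cong₂ _⊞_ (⊡-zeroˡ u) (comb-𝟎 us)) (⊞-identityˡ 𝟎)

  comb-comb : ∀ {k t m} (c : V m) (as : Vec (V t) m) (us : Vec (V k) t) →
              comb c (map (λ a → comb a us) as) ≡ comb (comb c as) us
  comb-comb []      []       us = sym (comb-𝟎 us)
  comb-comb (x ∷ c) (a ∷ as) us = begin
    x ⊡ comb a us ⊞ comb c (map (λ a → comb a us) as)
      ≡⟨ cong₂ _⊞_ (sym (comb-⊡ x a us)) (comb-comb c as us) ⟩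
    comb (x ⊡ a) us ⊞ comb (comb c as) us
      ≡⟨ sym (comb-⊞ (x ⊡ a) (comb c as) us) ⟩
    comb (x ⊡ a ⊞ comb c as) us ∎

  comb-++ : ∀ {k j m} (a : V j) (b : V m) (xs : Vec (V k) j) (ys : Vec (V k) m) →
            comb (a ++ b) (xs ++ ys) ≡ comb a xs ⊞ comb b ys
  comb-++ []      b []       ys = sym (⊞-identityˡ _)
  comb-++ (x ∷ a) b (u ∷ xs) ys = trans (cong (x ⊡ u ⊞_) (comb-++ a b xs ys)) (sym (⊞-assoc _ _ _))

  ⟨⟩-comm : ∀ {k} (u v : V k) → ⟨ u ∣ v ⟩ ≡ ⟨ v ∣ u ⟩
  ⟨⟩-comm []      []      = refl
  ⟨⟩-comm (x ∷ u) (y ∷ v) = cong₂ _+_ (*-comm x y) (⟨⟩-comm u v)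

  ⟨⟩-⊞ʳ : ∀ {k} (u v w : V k) → ⟨ u ∣ v ⊞ w ⟩ ≡ ⟨ u ∣ v ⟩ + ⟨ u ∣ w ⟩
  ⟨⟩-⊞ʳ []      []      []      = sym (+-identityˡ 0#)
  ⟨⟩-⊞ʳ (x ∷ u) (y ∷ v) (z ∷ w) = begin
    x * (y + z) + ⟨ u ∣ v ⊞ w ⟩               ≡⟨ cong₂ _+_ (distribˡ x y z) (⟨⟩-⊞ʳ u v w) ⟩
    (x * y + x * z) + (⟨ u ∣ v ⟩ + ⟨ u ∣ w ⟩) ≡⟨ +-interchange _ _ _ _ ⟩
    (x * y + ⟨ u ∣ v ⟩) + (x * z + ⟨ u ∣ w ⟩) ∎

  ⟨⟩-⊡ʳ : ∀ {k} (u : V k) c (v : V k) → ⟨ u ∣ c ⊡ v ⟩ ≡ c * ⟨ u ∣ v ⟩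
  ⟨⟩-⊡ʳ []      c []      = sym (zeroʳ c)
  ⟨⟩-⊡ʳ (x ∷ u) c (y ∷ v) = begin
    x * (c * y) + ⟨ u ∣ c ⊡ v ⟩ ≡⟨ cong₂ _+_ (sym (*-assoc x c y)) (⟨⟩-⊡ʳ u c v) ⟩
    (x * c) * y + c * ⟨ u ∣ v ⟩ ≡⟨ cong (λ a → a * y + c * ⟨ u ∣ v ⟩) (*-comm x c) ⟩
    (c * x) * y + c * ⟨ u ∣ v ⟩ ≡⟨ cong (_+ c * ⟨ u ∣ v ⟩) (*-assoc c x y) ⟩
    c * (x * y) + c * ⟨ u ∣ v ⟩ ≡⟨ sym (distribˡ c _ _) ⟩
    c * (x * y + ⟨ u ∣ v ⟩)     ∎

  ⟨⟩-𝟎ʳ : ∀ {k} (u : V k) → ⟨ u ∣ 𝟎 ⟩ ≡ 0#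
  ⟨⟩-𝟎ʳ []      = refl
  ⟨⟩-𝟎ʳ (x ∷ u) = trans (cong₂ _+_ (zeroʳ x) (⟨⟩-𝟎ʳ u)) (+-identityˡ 0#)

  ⟨⟩-combˡ : ∀ {k t} (cs : V t) (bs : Vec (V k) t) v → ⟨ comb cs bs ∣ v ⟩ ≡ ⟨ cs ∣ map ⟨_∣ v ⟩ bs ⟩
  ⟨⟩-combˡ []       []       v = trans (⟨⟩-comm 𝟎 v) (⟨⟩-𝟎ʳ v)
  ⟨⟩-combˡ (x ∷ cs) (b ∷ bs) v = begin
    ⟨ x ⊡ b ⊞ comb cs bs ∣ v ⟩                ≡⟨ ⟨⟩-comm _ v ⟩
    ⟨ v ∣ x ⊡ b ⊞ comb cs bs ⟩                ≡⟨ ⟨⟩-⊞ʳ v _ _ ⟩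
    ⟨ v ∣ x ⊡ b ⟩ + ⟨ v ∣ comb cs bs ⟩        ≡⟨ cong₂ _+_ (⟨⟩-⊡ʳ v x b) (⟨⟩-comm v _) ⟩
    x * ⟨ v ∣ b ⟩ + ⟨ comb cs bs ∣ v ⟩
      ≡⟨ cong₂ (λ a z → x * a + z) (⟨⟩-comm v b) (⟨⟩-combˡ cs bs v) ⟩
    x * ⟨ b ∣ v ⟩ + ⟨ cs ∣ map ⟨_∣ v ⟩ bs ⟩ ∎

  ⟨⟩-nondegenerate : ∀ {k} (z : V k) → (∀ v → ⟨ z ∣ v ⟩ ≡ 0#) → z ≡ 𝟎
  ⟨⟩-nondegenerate []      h = refl
  ⟨⟩-nondegenerate (x ∷ z) h =
    cong₂ _∷_ x≡0 (⟨⟩-nondegenerate z λ v → trans (sym (tail-term v)) (h (0# ∷ v)))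
    where
    x≡0 : x ≡ 0#
    x≡0 = begin
      x                ≡⟨ sym (*-identityʳ x) ⟩
      x * 1#           ≡⟨ sym (+-identityʳ _) ⟩
      x * 1# + 0#      ≡⟨ cong (x * 1# +_) (sym (⟨⟩-𝟎ʳ z)) ⟩
      x * 1# + ⟨ z ∣ 𝟎 ⟩ ≡⟨ h (1# ∷ 𝟎) ⟩
      0#               ∎
    tail-term : ∀ v → x * 0# + ⟨ z ∣ v ⟩ ≡ ⟨ z ∣ v ⟩
    tail-term v = trans (cong (_+ ⟨ z ∣ v ⟩) (zeroʳ x)) (+-identityˡ _)

  dots : ∀ {k d} → Vec (V k) d → V k → V d
  dots ys v = map ⟨_∣ v ⟩ ys

  dots-⊞ : ∀ {k d} (ys : Vec (V k) d) u v → dots ys (u ⊞ v) ≡ dots ys u ⊞ dots ys v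
  dots-⊞ []       u v = refl
  dots-⊞ (y ∷ ys) u v = cong₂ _∷_ (⟨⟩-⊞ʳ y u v) (dots-⊞ ys u v)

  dots-⊡ : ∀ {k d} (ys : Vec (V k) d) c v → dots ys (c ⊡ v) ≡ c ⊡ dots ys v
  dots-⊡ []       c v = refl
  dots-⊡ (y ∷ ys) c v = cong₂ _∷_ (⟨⟩-⊡ʳ y c v) (dots-⊡ ys c v)

  dots-𝟎 : ∀ {k d} (ys : Vec (V k) d) → dots ys 𝟎 ≡ 𝟎
  dots-𝟎 []       = refl
  dots-𝟎 (y ∷ ys) = cong₂ _∷_ (⟨⟩-𝟎ʳ y) (dots-𝟎 ys)

  dots-comb : ∀ {k d t} (ys : Vec (V k) d) (c : V t) (us : Vec (V k) t) →
              comb c (map (dots ys) us) ≡ dots ys (comb c us)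
  dots-comb ys []      []       = sym (dots-𝟎 ys)
  dots-comb ys (x ∷ c) (u ∷ us) = begin
    x ⊡ dots ys u ⊞ comb c (map (dots ys) us) ≡⟨ cong₂ _⊞_ (sym (dots-⊡ ys x u)) (dots-comb ys c us) ⟩
    dots ys (x ⊡ u) ⊞ dots ys (comb c us)     ≡⟨ sym (dots-⊞ ys _ _) ⟩
    dots ys (x ⊡ u ⊞ comb c us)               ∎

  Independent : ∀ {k m} → Vec (V k) m → Set
  Independent {m = m} vs = ∀ (cs : V m) → comb cs vs ≡ 𝟎 → cs ≡ 𝟎

  JointlyIndependent : ∀ {k j m} → Vec (V k) j → Vec (V k) m → Set
  JointlyIndependent {j = j} {m} zs vs =
    ∀ (a : V j) (b : V m) → comb a zs ⊞ comb b vs ≡ 𝟎 → a ≡ 𝟎 × b ≡ 𝟎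

  JointlyIndependent-shift : ∀ {k j m} {v : V k} (zs : Vec (V k) j) (rest : Vec (V k) m) →
                             JointlyIndependent zs (v ∷ rest) → JointlyIndependent (v ∷ zs) rest
  JointlyIndependent-shift {v = v} zs rest ind (a₀ ∷ a) b h =
    cong₂ _∷_ (proj₁ (∷-injective a₀∷b≡𝟎)) a≡𝟎 , proj₂ (∷-injective a₀∷b≡𝟎)
    where
    regroup : comb a zs ⊞ (a₀ ⊡ v ⊞ comb b rest) ≡ (a₀ ⊡ v ⊞ comb a zs) ⊞ comb b rest
    regroup = trans (sym (⊞-assoc _ _ _)) (cong (_⊞ comb b rest) (⊞-comm _ _))
    a≡𝟎 : a ≡ 𝟎
    a≡𝟎 = proj₁ (ind a (a₀ ∷ b) (trans regroup h))
    a₀∷b≡𝟎 : a₀ ∷ b ≡ 𝟎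
    a₀∷b≡𝟎 = proj₂ (ind a (a₀ ∷ b) (trans regroup h))

  𝟎-++ : ∀ j {m} → 𝟎 {j} ++ 𝟎 {m} ≡ 𝟎
  𝟎-++ zero    = refl
  𝟎-++ (suc j) = cong (0# ∷_) (𝟎-++ j)

  comb-head∷tail : ∀ {k t} (c : V t) (zs : Vec (V (suc k)) t) →
                   comb c zs ≡ ⟨ c ∣ map head zs ⟩ ∷ comb c (map tail zs)
  comb-head∷tail []      []             = refl
  comb-head∷tail (x ∷ c) ((a ∷ z) ∷ zs) = cong (x ⊡ (a ∷ z) ⊞_) (comb-head∷tail c zs)

  comb-zero-heads : ∀ {k t} (c : V t) (zs : Vec (V (suc k)) t) → map head zs ≡ 𝟎 →
                    comb c zs ≡ 0# ∷ comb c (map tail zs)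
  comb-zero-heads c zs heads≡𝟎 = begin
    comb c zs                       ≡⟨ comb-head∷tail c zs ⟩
    ⟨ c ∣ map head zs ⟩ ∷ tail-comb ≡⟨ cong (λ hs → ⟨ c ∣ hs ⟩ ∷ tail-comb) heads≡𝟎 ⟩
    ⟨ c ∣ 𝟎 ⟩ ∷ tail-comb           ≡⟨ cong (_∷ tail-comb) (⟨⟩-𝟎ʳ c) ⟩
    0# ∷ tail-comb                  ∎
    where
    tail-comb = comb c (map tail zs)

  tails-independent : ∀ {k m} (zs : Vec (V (suc k)) m) → map head zs ≡ 𝟎 →
                      Independent zs → Independent (map tail zs)
  tails-independent zs heads≡𝟎 ind c h = ind c (trans (comb-zero-heads c zs heads≡𝟎) (cong (0# ∷_) h))

  comb-map-shift : ∀ {k t} (g : V k → Carrier) (v : V k) (b : V t) (us : Vec (V k) t) →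
                   comb b (map (λ u → u ⊞ g u ⊡ v) us) ≡ comb b us ⊞ ⟨ b ∣ map g us ⟩ ⊡ v
  comb-map-shift g v []      []       = sym (trans (⊞-identityˡ _) (⊡-zeroˡ v))
  comb-map-shift g v (c ∷ b) (u ∷ us) = begin
    c ⊡ (u ⊞ g u ⊡ v) ⊞ comb b (map (λ u → u ⊞ g u ⊡ v) us)
      ≡⟨ cong₂ _⊞_ (trans (⊡-distribˡ c u _) (cong (c ⊡ u ⊞_) (sym (⊡-assoc c (g u) v))))
                   (comb-map-shift g v b us) ⟩
    (c ⊡ u ⊞ (c * g u) ⊡ v) ⊞ (comb b us ⊞ ⟨ b ∣ map g us ⟩ ⊡ v)
      ≡⟨ ⊞-interchange _ _ _ _ ⟩
    (c ⊡ u ⊞ comb b us) ⊞ ((c * g u) ⊡ v ⊞ ⟨ b ∣ map g us ⟩ ⊡ v)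
      ≡⟨ cong ((c ⊡ u ⊞ comb b us) ⊞_) (sym (⊡-distribʳ _ _ v)) ⟩
    (c ⊡ u ⊞ comb b us) ⊞ (c * g u + ⟨ b ∣ map g us ⟩) ⊡ v ∎

  module Pivot {k} (v₀ : Carrier) (v′ : V k) (p : Carrier) (p*v₀≡1 : p * v₀ ≡ 1#) where
    pivot : V (suc k)
    pivot = v₀ ∷ v′

    factor : V (suc k) → Carrier
    factor u = - (head u * p)

    clear : V (suc k) → V (suc k)
    clear u = u ⊞ factor u ⊡ pivot

    head-clear : ∀ u → head (clear u) ≡ 0#
    head-clear (a ∷ u) = begin
      a + - (a * p) * v₀   ≡⟨ cong (a +_) (sym (-‿distribˡ-* (a * p) v₀)) ⟩
      a + - ((a * p) * v₀) ≡⟨ cong (λ z → a + - z) (trans (*-assoc a p v₀) (cong (a *_) p*v₀≡1)) ⟩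
      a + - (a * 1#)       ≡⟨ cong (λ z → a + - z) (*-identityʳ a) ⟩
      a + - a              ≡⟨ -‿inverseʳ a ⟩
      0#                   ∎

    heads-clear : ∀ {m} (us : Vec (V (suc k)) m) → map head (map clear us) ≡ 𝟎
    heads-clear []       = refl
    heads-clear (u ∷ us) = cong₂ _∷_ (head-clear u) (heads-clear us)

    cleared-tails-independent : ∀ {j m} (zs : Vec (V (suc k)) j) (rest : Vec (V (suc k)) m) →
      map head zs ≡ 𝟎 → JointlyIndependent zs (pivot ∷ rest) →
      Independent (map tail zs ++ map tail (map clear rest))
    cleared-tails-independent {j} zs rest heads≡𝟎 ind cs h with a , b , refl ← splitAt j cs
      = trans (cong₂ _++_ a≡𝟎 (proj₂ (∷-injective μ∷b≡𝟎))) (𝟎-++ j)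
      where
      μ : Carrier
      μ = ⟨ b ∣ map factor rest ⟩
      lifted : comb a zs ⊞ comb b (map clear rest) ≡ 𝟎
      lifted = begin
        comb a zs ⊞ comb b (map clear rest)
          ≡⟨ cong₂ _⊞_ (comb-zero-heads a zs heads≡𝟎) (comb-zero-heads b _ (heads-clear rest)) ⟩
        (0# + 0#) ∷ (comb a (map tail zs) ⊞ comb b (map tail (map clear rest)))
          ≡⟨ cong₂ _∷_ (+-identityˡ 0#) (trans (sym (comb-++ a b _ _)) h) ⟩
        0# ∷ 𝟎 ∎
      unfolded : comb a zs ⊞ comb (μ ∷ b) (pivot ∷ rest) ≡ 𝟎
      unfolded = begin
        comb a zs ⊞ (μ ⊡ pivot ⊞ comb b rest) ≡⟨ cong (comb a zs ⊞_) (⊞-comm _ _) ⟩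
        comb a zs ⊞ (comb b rest ⊞ μ ⊡ pivot)
          ≡⟨ cong (comb a zs ⊞_) (sym (comb-map-shift factor pivot b rest)) ⟩
        comb a zs ⊞ comb b (map clear rest)   ≡⟨ lifted ⟩
        𝟎                                     ∎
      a≡𝟎 : a ≡ 𝟎
      a≡𝟎 = proj₁ (ind a (μ ∷ b) unfolded)
      μ∷b≡𝟎 : μ ∷ b ≡ 𝟎
      μ∷b≡𝟎 = proj₂ (ind a (μ ∷ b) unfolded)

  -- Gaussian elimination in the first coordinate: zs collects vectors with head 0, and the first
  -- vector with a nonzero head is the pivot that clears the heads of the remaining ones.
  module _ {k} (rank-bound-k : ∀ {m} (vs : Vec (V k) m) → Independent vs → m ≤ k) where
    rank-bound-suc : ∀ {j m} (zs : Vec (V (suc k)) j) (vs : Vec (V (suc k)) m) →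
                     map head zs ≡ 𝟎 → JointlyIndependent zs vs → j +ℕ m ≤ suc k
    rank-bound-suc {j} zs [] heads≡𝟎 ind =
      subst (_≤ suc k) (sym (ℕₚ.+-identityʳ j))
        (ℕₚ.m≤n⇒m≤1+n (rank-bound-k _ (tails-independent zs heads≡𝟎 zs-independent)))
      where
      zs-independent : Independent zs
      zs-independent c h = proj₁ (ind c [] (trans (⊞-identityʳ _) h))
    rank-bound-suc {j} zs ((v₀ ∷ v′) ∷ rest) heads≡𝟎 ind with v₀ ≟ᶠ 0#
    ... | yes v₀≡0 = subst (_≤ suc k) (sym (ℕₚ.+-suc j _))
      (rank-bound-suc (_ ∷ zs) rest (cong₂ _∷_ v₀≡0 heads≡𝟎) (JointlyIndependent-shift zs rest ind))
    ... | no v₀≢0 with p , v₀*p≡1 ← inverse v₀ v₀≢0 = subst (_≤ suc k) (sym (ℕₚ.+-suc j _))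
      (s≤s (rank-bound-k _ (cleared-tails-independent zs rest heads≡𝟎 ind)))
      where open Pivot v₀ v′ p (trans (*-comm p v₀) v₀*p≡1)

  rank-bound : ∀ k {m} (vs : Vec (V k) m) → Independent vs → m ≤ k
  rank-bound zero    []       ind = z≤n
  rank-bound zero    (v ∷ vs) ind = ⊥-elim (0≢1 (sym (proj₁ (∷-injective (ind (1# ∷ 𝟎) (V₀-trivial _))))))
    where
    V₀-trivial : (u : V 0) → u ≡ []
    V₀-trivial [] = refl
  rank-bound (suc k) vs ind =
    rank-bound-suc (rank-bound k) [] vs refl λ { [] b h → refl , ind b (trans (sym (⊞-identityˡ _)) h) }

  ∃-dec : {Q : Carrier → Set} → (∀ x → Dec (Q x)) → Dec (∃ Q)
  ∃-dec Q? = map′ (λ any → let x , _ , q = find any in x , q) (λ (x , q) → lose (complete x) q)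
                  (any? Q? elements)

  ∃ᵛ-dec : ∀ k {P : V k → Set} → (∀ v → Dec (P v)) → Dec (∃ P)
  ∃ᵛ-dec zero    P? = map′ ([] ,_) (λ { ([] , p) → p }) (P? [])
  ∃ᵛ-dec (suc k) P? = map′ (λ (x , v , p) → x ∷ v , p) (λ { (x ∷ v , p) → x , v , p })
                           (∃-dec λ x → ∃ᵛ-dec k λ v → P? (x ∷ v))

module Subspaces (𝔽 : FiniteField) (n : ℕ) where
  open FiniteField 𝔽 renaming (_≟_ to _≟ᶠ_)
  open Vectors 𝔽
  open CommutativeRing carrierRing using (*-comm)
  open ≡-Reasoning

  Sub : Set₁
  Sub = Subspace 𝔽 n

  infix 4 _∋_ _⊆ˢ_

  _∋_ : Sub → V n → Set
  X ∋ v = Subspace.mem X v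

  _⊆ˢ_ : Sub → Sub → Set
  _⊆ˢ_ = _⊆_ 𝔽 n

  comb-∈ : ∀ {t} (X : Sub) (c : V t) (us : Vec (V n) t) → AllIn 𝔽 n X us → X ∋ comb c us
  comb-∈ X []      []       []         = Subspace.mem-0 X
  comb-∈ X (x ∷ c) (u ∷ us) (u∈X ∷ us∈X) = Subspace.mem-+ X (Subspace.mem-· X x u∈X) (comb-∈ X c us us∈X)

  zeroSub : Sub
  zeroSub = record
    { mem   = _≡ 𝟎
    ; mem?  = λ v → ≡-dec _≟ᶠ_ v 𝟎
    ; mem-0 = refl
    ; mem-+ = λ { refl refl → ⊞-identityˡ 𝟎 }
    ; mem-· = λ { c refl → ⊡-zeroʳ c } }

  InSpanMod : ∀ {t} → Sub → Vec (V n) t → V n → Set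
  InSpanMod {t} W us v = Σ (V t) λ c → W ∋ v ⊞ comb c us

  IndependentMod : ∀ {t} → Sub → Vec (V n) t → Set
  IndependentMod W us = ∀ c → W ∋ comb c us → c ≡ 𝟎

  InSpanMod? : ∀ {t} (W : Sub) (us : Vec (V n) t) v → Dec (InSpanMod W us v)
  InSpanMod? {t} W us v = ∃ᵛ-dec t λ c → Subspace.mem? W (v ⊞ comb c us)

  InSpanMod-zeroSub : ∀ {t} (us : Vec (V n) t) v → InSpanMod zeroSub us v → ∃ λ c → comb c us ≡ v
  InSpanMod-zeroSub us v (c , v+cus≡𝟎) = (- 1#) ⊡ c , sym (begin
    v                          ≡⟨ sym ([u⊞v]⊟v≡u v (comb c us)) ⟩
    (v ⊞ comb c us) ⊟ comb c us ≡⟨ cong (_⊟ comb c us) v+cus≡𝟎 ⟩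
    𝟎 ⊟ comb c us               ≡⟨ ⊞-identityˡ _ ⟩
    (- 1#) ⊡ comb c us          ≡⟨ sym (comb-⊡ (- 1#) c us) ⟩
    comb ((- 1#) ⊡ c) us        ∎)

  IndependentMod-∷ : ∀ {t} (W : Sub) (us : Vec (V n) t) v →
                     IndependentMod W us → ¬ InSpanMod W us v → IndependentMod W (v ∷ us)
  IndependentMod-∷ W us v ind v∉ (c₀ ∷ c) h with c₀ ≟ᶠ 0#
  ... | yes refl =
    cong (0# ∷_) (ind c (subst (W ∋_) (trans (cong (_⊞ comb c us) (⊡-zeroˡ v)) (⊞-identityˡ _)) h))
  ... | no c₀≢0 with p , c₀*p≡1 ← inverse c₀ c₀≢0 =
    ⊥-elim (v∉ (p ⊡ c , subst (W ∋_) rescale (Subspace.mem-· W p h)))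
    where
    rescale : p ⊡ (c₀ ⊡ v ⊞ comb c us) ≡ v ⊞ comb (p ⊡ c) us
    rescale = begin
      p ⊡ (c₀ ⊡ v ⊞ comb c us)   ≡⟨ ⊡-distribˡ p _ _ ⟩
      p ⊡ (c₀ ⊡ v) ⊞ p ⊡ comb c us ≡⟨ cong₂ _⊞_ (sym (⊡-assoc p c₀ v)) (sym (comb-⊡ p c us)) ⟩
      (p * c₀) ⊡ v ⊞ scaled        ≡⟨ cong (λ a → a ⊡ v ⊞ scaled) (trans (*-comm p c₀) c₀*p≡1) ⟩
      1# ⊡ v ⊞ scaled              ≡⟨ cong (_⊞ scaled) (⊡-identityˡ v) ⟩
      v ⊞ scaled                   ∎
      where
      scaled = comb (p ⊡ c) us

  record BasisModulo (W X : Sub) : Set where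
    field
      {size}      : ℕ
      vectors     : Vec (V n) size
      vectors∈X   : AllIn 𝔽 n X vectors
      independent : IndependentMod W vectors
      spanning    : ∀ v → X ∋ v → InSpanMod W vectors v

  module _ (W X : Sub) {B : ℕ}
           (bounded : ∀ {t} (us : Vec (V n) t) → AllIn 𝔽 n X us → IndependentMod W us → t ≤ B) where

    -- s is fuel; it cannot run out since W-independent families in X have length at most B.
    extend-to-BasisModulo : ∀ s {t} (us : Vec (V n) t) → t +ℕ s ≡ B →
                            AllIn 𝔽 n X us → IndependentMod W us → BasisModulo W X
    extend-to-BasisModulo s {t} us t+s≡B us∈X ind
      with ∃ᵛ-dec n (λ v → Subspace.mem? X v ×-dec ¬? (InSpanMod? W us v))
    ... | no none = record
      { vectors = us ; vectors∈X = us∈X ; independent = ind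
      ; spanning = λ v v∈X → decidable-stable (InSpanMod? W us v) (λ v∉ → none (v , v∈X , v∉)) }
    ... | yes (v , v∈X , v∉) with s | bounded (v ∷ us) (v∈X ∷ us∈X) (IndependentMod-∷ W us v ind v∉)
    ...   | zero   | t<B = ⊥-elim (ℕₚ.n≮n t (subst (t <_) (trans (sym t+s≡B) (ℕₚ.+-identityʳ t)) t<B))
    ...   | suc s′ | _   = extend-to-BasisModulo s′ (v ∷ us) (trans (sym (ℕₚ.+-suc t s′)) t+s≡B)
                                                (v∈X ∷ us∈X) (IndependentMod-∷ W us v ind v∉)

    basisModulo : BasisModulo W X
    basisModulo = extend-to-BasisModulo B [] refl [] (λ { [] _ → refl })

  dimension : (X : Sub) → ∃ (IsDim 𝔽 n X)
  dimension X = size , vectors , vectors∈X , independent ,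
                λ v v∈X → InSpanMod-zeroSub vectors v (spanning v v∈X)
    where open BasisModulo (basisModulo zeroSub X (λ us _ ind → rank-bound n us ind))

  coordinates : ∀ {t m} (X : Sub) (us : Vec (V n) t) → (∀ v → X ∋ v → ∃ λ c → comb c us ≡ v) →
                (vs : Vec (V n) m) → AllIn 𝔽 n X vs → Σ (Vec (V t) m) λ as → map (λ a → comb a us) as ≡ vs
  coordinates X us spanning []       []           = [] , refl
  coordinates X us spanning (v ∷ vs) (v∈X ∷ vs∈X)
    with c , refl ← spanning v v∈X | as , refl ← coordinates X us spanning vs vs∈X = c ∷ as , refl

  steinitz : ∀ {t m} (X : Sub) (us : Vec (V n) t) → (∀ v → X ∋ v → ∃ λ c → comb c us ≡ v) →
             (vs : Vec (V n) m) → AllIn 𝔽 n X vs → Independent vs → m ≤ t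
  steinitz {t} X us spanning vs vs∈X ind with as , refl ← coordinates X us spanning vs vs∈X =
    rank-bound t as λ c h → ind c (trans (comb-comb c as us) (trans (cong (λ a → comb a us) h) (comb-𝟎 us)))

  infixl 6 _+⟨_⟩ _+span_

  _+⟨_⟩ : Sub → V n → Sub
  X +⟨ e ⟩ = record
    { mem   = λ v → ∃ λ x → ∃ λ c → X ∋ x × v ≡ x ⊞ c ⊡ e
    ; mem?  = λ v → map′ (λ (c , h) → _ , c , h , sym ([u⊟v]⊞v≡u v (c ⊡ e)))
                         (λ { (x , c , x∈X , refl) → c , subst (X ∋_) (sym ([u⊞v]⊟v≡u x (c ⊡ e))) x∈X })
                         (∃-dec λ c → Subspace.mem? X (v ⊟ c ⊡ e))
    ; mem-0 = 𝟎 , 0# , Subspace.mem-0 X , sym (trans (⊞-identityˡ _) (⊡-zeroˡ e))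
    ; mem-+ = λ { (x , c , x∈X , refl) (x′ , c′ , x′∈X , refl) →
                  x ⊞ x′ , c + c′ , Subspace.mem-+ X x∈X x′∈X ,
                  trans (⊞-interchange x _ x′ _) (cong (x ⊞ x′ ⊞_) (sym (⊡-distribʳ c c′ e))) }
    ; mem-· = λ { a (x , c , x∈X , refl) → a ⊡ x , a * c , Subspace.mem-· X a x∈X ,
                  trans (⊡-distribˡ a x _) (cong (a ⊡ x ⊞_) (sym (⊡-assoc a c e))) } }

  ⟨_⟩ˢ : V n → Sub
  ⟨ u ⟩ˢ = record
    { mem   = λ v → ∃ λ c → v ≡ c ⊡ u
    ; mem?  = λ v → ∃-dec λ c → ≡-dec _≟ᶠ_ v (c ⊡ u)
    ; mem-0 = 0# , sym (⊡-zeroˡ u)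
    ; mem-+ = λ { (c , refl) (c′ , refl) → c + c′ , sym (⊡-distribʳ c c′ u) }
    ; mem-· = λ { a (c , refl) → a * c , sym (⊡-assoc a c u) } }

  ⟨⟩ˢ-dim≤1 : ∀ u → ∃ λ d → d ≤ 1 × IsDim 𝔽 n ⟨ u ⟩ˢ d
  ⟨⟩ˢ-dim≤1 u with d , bs , basis@(bs∈L , ind , _) ← dimension ⟨ u ⟩ˢ =
    d , steinitz ⟨ u ⟩ˢ (u ∷ []) (λ { v (c , refl) → c ∷ [] , ⊞-identityʳ _ }) bs bs∈L ind , bs , basis

  +⟨⟩-IsSumSpan : ∀ (X : Sub) e → IsSumSpan 𝔽 n X e (X +⟨ e ⟩)
  +⟨⟩-IsSumSpan X e v = mk⇔ id id

  +⟨⟩-IsSum : ∀ (X : Sub) u → IsSum 𝔽 n X ⟨ u ⟩ˢ (X +⟨ u ⟩)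
  +⟨⟩-IsSum X u v = mk⇔ (λ { (x , c , x∈X , eq) → x , c ⊡ u , x∈X , (c , refl) , eq })
                        (λ { (x , _ , x∈X , (c , refl) , eq) → x , c , x∈X , eq })

  _+span_ : ∀ {t} → Sub → Vec (V n) t → Sub
  W +span []       = W
  W +span (u ∷ us) = (W +span us) +⟨ u ⟩

  ⊞-comb-∈-+span : ∀ {t} (W : Sub) (us : Vec (V n) t) c w → W ∋ w → W +span us ∋ w ⊞ comb c us
  ⊞-comb-∈-+span W []       []       w w∈W = subst (W ∋_) (sym (⊞-identityʳ w)) w∈W
  ⊞-comb-∈-+span W (u ∷ us) (c₀ ∷ c) w w∈W =
    w ⊞ comb c us , c₀ , ⊞-comb-∈-+span W us c w w∈W ,
    trans (cong (w ⊞_) (⊞-comm (c₀ ⊡ u) (comb c us))) (sym (⊞-assoc w (comb c us) (c₀ ⊡ u)))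

  InSpanMod→+span : ∀ {t} (W : Sub) (us : Vec (V n) t) v → InSpanMod W us v → W +span us ∋ v
  InSpanMod→+span W us v (c , v+cus∈W) =
    subst (W +span us ∋_) v+cus-cus≡v (⊞-comb-∈-+span W us ((- 1#) ⊡ c) _ v+cus∈W)
    where
    v+cus-cus≡v : (v ⊞ comb c us) ⊞ comb ((- 1#) ⊡ c) us ≡ v
    v+cus-cus≡v = trans (cong (v ⊞ comb c us ⊞_) (comb-⊡ (- 1#) c us)) ([u⊞v]⊟v≡u v _)

  ⟨comb∣⟩-orthogonal : ∀ {t} (cs : V t) (bs : Vec (V n) t) v → dots bs v ≡ 𝟎 → ⟨ comb cs bs ∣ v ⟩ ≡ 0#
  ⟨comb∣⟩-orthogonal cs bs v bs⊥v = trans (⟨⟩-combˡ cs bs v) (trans (cong ⟨ cs ∣_⟩ bs⊥v) (⟨⟩-𝟎ʳ cs))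

  perpSub : ∀ {d} → Vec (V n) d → Sub
  perpSub bs = record
    { mem   = λ v → dots bs v ≡ 𝟎
    ; mem?  = λ v → ≡-dec _≟ᶠ_ (dots bs v) 𝟎
    ; mem-0 = dots-𝟎 bs
    ; mem-+ = λ {u} {v} hu hv → trans (dots-⊞ bs u v) (trans (cong₂ _⊞_ hu hv) (⊞-identityˡ 𝟎))
    ; mem-· = λ c {v} hv → trans (dots-⊡ bs c v) (trans (cong (c ⊡_) hv) (⊡-zeroʳ c)) }

  perpSub-IsPerp : ∀ {d} (X : Sub) (bs : Vec (V n) d) → IsBasis 𝔽 n X bs → IsPerp 𝔽 n X (perpSub bs)
  perpSub-IsPerp X bs (bs∈X , _ , spanning) v = mk⇔ orthogonal vanishing
    where
    orthogonal : dots bs v ≡ 𝟎 → ∀ x → X ∋ x → ⟨ x ∣ v ⟩ ≡ 0#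
    orthogonal bs⊥v x x∈X with cs , refl ← spanning x x∈X = ⟨comb∣⟩-orthogonal cs bs v bs⊥v
    vanishing : (∀ x → X ∋ x → ⟨ x ∣ v ⟩ ≡ 0#) → dots bs v ≡ 𝟎
    vanishing X⊥v = go bs∈X
      where
      go : ∀ {e} {cs : Vec (V n) e} → AllIn 𝔽 n X cs → dots cs v ≡ 𝟎
      go []           = refl
      go (c∈X ∷ cs∈X) = cong₂ _∷_ (X⊥v _ c∈X) (go cs∈X)

  perp : (X : Sub) → Σ Sub (IsPerp 𝔽 n X)
  perp X with d , bs , basis ← dimension X = perpSub bs , perpSub-IsPerp X bs basis

  perp-unique : ∀ Z P Q → IsPerp 𝔽 n Z P → IsPerp 𝔽 n Z Q → P ⊆ˢ Q
  perp-unique Z P Q Z⊥P Z⊥Q v v∈P = Equivalence.from (Z⊥Q v) (Equivalence.to (Z⊥P v) v∈P)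

  perp-antitone : ∀ X S Y Z → X ⊆ˢ S → IsPerp 𝔽 n X Y → IsPerp 𝔽 n S Z → Z ⊆ˢ Y
  perp-antitone X S Y Z X⊆S X⊥Y S⊥Z z z∈Z =
    Equivalence.from (X⊥Y z) λ x x∈X → Equivalence.to (S⊥Z z) z∈Z x (X⊆S x x∈X)

  independent-∷ : ∀ {d} (X : Sub) (bs : Vec (V n) d) → IsBasis 𝔽 n X bs → ∀ w → ¬ X ∋ w → Independent (w ∷ bs)
  independent-∷ X bs (bs∈X , ind , _) w w∉X = IndependentMod-∷ zeroSub bs w ind λ w∈span →
    let c , cbs≡w = InSpanMod-zeroSub bs w w∈span in w∉X (subst (X ∋_) cbs≡w (comb-∈ X c bs bs∈X))

  full-AllIn : ∀ {t} (vs : Vec (V n) t) → AllIn 𝔽 n (full 𝔽 n) vs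
  full-AllIn []       = []
  full-AllIn (v ∷ vs) = tt ∷ full-AllIn vs

  -- v ↦ (⟨yᵢ ∣ v⟩)ᵢ has kernel W, so it maps families independent modulo W to independent ones.
  complement-spans : ∀ {d} (Y : Sub) (ys : Vec (V n) d) → IsBasis 𝔽 n Y ys → (W : Sub) → IsPerp 𝔽 n Y W →
                     Σ ℕ λ t → Σ (Vec (V n) t) λ us → t ≤ d × (∀ v → InSpanMod W us v)
  complement-spans {d} Y ys (_ , _ , spanning) W Y⊥W =
    size , vectors , bounded vectors vectors∈X independent , λ v → spanning-mod v tt
    where
    bounded : ∀ {t} (us : Vec (V n) t) → AllIn 𝔽 n (full 𝔽 n) us → IndependentMod W us → t ≤ d
    bounded us _ ind = rank-bound d (map (dots ys) us) λ c h →
      ind c (Equivalence.from (Y⊥W (comb c us)) λ y y∈Y →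
        let a , ays≡y = spanning y y∈Y
        in subst (λ y → ⟨ y ∣ comb c us ⟩ ≡ 0#) ays≡y
                 (⟨comb∣⟩-orthogonal a ys (comb c us) (trans (sym (dots-comb ys c us)) h)))
    open BasisModulo (basisModulo W (full 𝔽 n) bounded) renaming (spanning to spanning-mod)

  -- If U⊥ were 0, the whole space would be spanned by at most dim U vectors, yet U together with t₀
  -- contains dim U + 1 independent ones.
  orthogonal-nonzero : (U : Sub) (t₀ : V n) → ¬ U ∋ t₀ → ∃ λ a → ¬ a ≡ 𝟎 × (∀ u → U ∋ u → ⟨ u ∣ a ⟩ ≡ 0#)
  orthogonal-nonzero U t₀ t₀∉U
    with P , U⊥P ← perp U
    with ∃ᵛ-dec n (λ a → ¬? (≡-dec _≟ᶠ_ a 𝟎) ×-dec Subspace.mem? P a)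
  ... | yes (a , a≢𝟎 , a∈P) = a , a≢𝟎 , Equivalence.to (U⊥P a) a∈P
  ... | no P-trivial
    with e , bs , basis ← dimension U
    with t , us , t≤e , spanning ← complement-spans U bs basis P U⊥P =
    ⊥-elim (ℕₚ.≤⇒≯ t≤e (steinitz (full 𝔽 n) us spans (t₀ ∷ bs) (full-AllIn _)
                                  (independent-∷ U bs basis t₀ t₀∉U)))
    where
    spans : ∀ v → full 𝔽 n ∋ v → ∃ λ c → comb c us ≡ v
    spans v _ = let c , v+cus∈P = spanning v in
      InSpanMod-zeroSub us v (c , decidable-stable (≡-dec _≟ᶠ_ _ 𝟎) λ ≢𝟎 → P-trivial (_ , ≢𝟎 , v+cus∈P))

module Orthogonality (𝔽 : FiniteField) (n : ℕ) where
  open FiniteField 𝔽 using (0#; 1#; 0≢1) renaming (_≟_ to _≟ᶠ_)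
  open Vectors 𝔽
  open Subspaces 𝔽 n

  imageSub : ∀ {d} (zs : Vec (V n) d) → Subspace 𝔽 d
  imageSub zs = record
    { mem   = λ u → ∃ λ v → dots zs v ≡ u
    ; mem?  = λ u → ∃ᵛ-dec n λ v → ≡-dec _≟ᶠ_ (dots zs v) u
    ; mem-0 = 𝟎 , dots-𝟎 zs
    ; mem-+ = λ { (v , refl) (v′ , refl) → v ⊞ v′ , dots-⊞ zs v v′ }
    ; mem-· = λ { c (v , refl) → c ⊡ v , dots-⊡ zs c v } }

  -- For w ∈ X⊥⊥ outside X, the functionals ⟨w ∣_⟩, ⟨x₁ ∣_⟩, … are independent, so
  -- v ↦ (⟨w ∣ v⟩, ⟨x₁ ∣ v⟩, …) is onto; a preimage of (1, 0, …, 0) lies in X⊥ but not in w⊥.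
  perp-perp-⊆ : ∀ X Y W → IsPerp 𝔽 n X Y → IsPerp 𝔽 n Y W → W ⊆ˢ X
  perp-perp-⊆ X Y W X⊥Y Y⊥W w w∈W with Subspace.mem? X w
  ... | yes w∈X = w∈X
  ... | no w∉X
    with d , xs , basis@(_ , _ , spanning) ← dimension X
    with Subspace.mem? (imageSub (w ∷ xs)) (1# ∷ 𝟎)
  ... | yes (v , w·v∷xs·v≡1∷𝟎) = ⊥-elim (0≢1 (trans (sym w⊥v) (proj₁ (∷-injective w·v∷xs·v≡1∷𝟎))))
    where
    v∈Y : Y ∋ v
    v∈Y = Equivalence.from (X⊥Y v) λ x x∈X →
      let cs , cxs≡x = spanning x x∈X
      in subst (λ x → ⟨ x ∣ v ⟩ ≡ 0#) cxs≡x (⟨comb∣⟩-orthogonal cs xs v (proj₂ (∷-injective w·v∷xs·v≡1∷𝟎)))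
    w⊥v : ⟨ w ∣ v ⟩ ≡ 0#
    w⊥v = trans (⟨⟩-comm w v) (Equivalence.to (Y⊥W w) w∈W v v∈Y)
  ... | no 1∷𝟎∉image
    with a , a≢𝟎 , a⊥image ← Subspaces.orthogonal-nonzero 𝔽 (suc d) (imageSub (w ∷ xs)) (1# ∷ 𝟎) 1∷𝟎∉image =
    ⊥-elim (a≢𝟎 (independent-∷ X xs basis w w∉X a (⟨⟩-nondegenerate _ λ v →
      trans (⟨⟩-combˡ a (w ∷ xs) v) (trans (⟨⟩-comm a _) (a⊥image _ (v , refl))))))

  perp-sym : ∀ X Y → IsPerp 𝔽 n X Y → IsPerp 𝔽 n Y X
  perp-sym X Y X⊥Y v = mk⇔
    (λ v∈X y y∈Y → trans (⟨⟩-comm y v) (Equivalence.to (X⊥Y y) y∈Y v v∈X))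
    (λ Y⊥v → let P , Y⊥P = perp Y in perp-perp-⊆ X Y P X⊥Y Y⊥P v (Equivalence.from (Y⊥P v) Y⊥v))

m∸[m+n∸o]≡o∸n : ∀ m n o → o ≤ m +ℕ n → m ∸ ((m +ℕ n) ∸ o) ≡ o ∸ n
m∸[m+n∸o]≡o∸n m n o o≤m+n = begin
  m ∸ e                   ≡⟨ sym (ℕₚ.[m+n]∸[m+o]≡n∸o n m e) ⟩
  (n +ℕ m) ∸ (n +ℕ e)     ≡⟨ cong₂ _∸_ (ℕₚ.+-comm n m) (ℕₚ.+-comm n e) ⟩
  (m +ℕ n) ∸ (e +ℕ n)     ≡⟨ cong (_∸ (e +ℕ n)) (sym (ℕₚ.m+[n∸m]≡n o≤m+n)) ⟩
  (o +ℕ e) ∸ (e +ℕ n)     ≡⟨ cong (_∸ (e +ℕ n)) (ℕₚ.+-comm o e) ⟩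
  (e +ℕ o) ∸ (e +ℕ n)     ≡⟨ ℕₚ.[m+n]∸[m+o]≡n∸o e o n ⟩
  o ∸ n                   ∎
  where
  e = (m +ℕ n) ∸ o
  open ≡-Reasoning

module Duality (𝔽 : FiniteField) {n : ℕ} (M : QMatroid 𝔽 n) where
  open FiniteField 𝔽 using (0#; 1#)
  open Vectors 𝔽
  open Subspaces 𝔽 n
  open Orthogonality 𝔽 n
  open QMatroid M
  open ℕₚ.≤-Reasoning

  ρE : ℕ
  ρE = ρ (full 𝔽 n)

  ρ≤ρE : ∀ A → ρ A ≤ ρE
  ρ≤ρE A = ρ-mono A (full 𝔽 n) (λ _ _ → tt)

  ρ-+⟨⟩ : ∀ X u → ρ (X +⟨ u ⟩) ≤ suc (ρ X)
  ρ-+⟨⟩ X u with d , d≤1 , dim ← ⟨⟩ˢ-dim≤1 u = begin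
    ρ (X +⟨ u ⟩)                       ≤⟨ ℕₚ.m≤m+n _ _ ⟩
    ρ (X +⟨ u ⟩) +ℕ ρ (_∩_ 𝔽 n X ⟨ u ⟩ˢ) ≤⟨ ρ-sub X ⟨ u ⟩ˢ (X +⟨ u ⟩) (+⟨⟩-IsSum X u) ⟩
    ρ X +ℕ ρ ⟨ u ⟩ˢ                    ≤⟨ ℕₚ.+-monoʳ-≤ (ρ X) (ℕₚ.≤-trans (ρ-dim _ d dim) d≤1) ⟩
    ρ X +ℕ 1                           ≡⟨ ℕₚ.+-comm (ρ X) 1 ⟩
    suc (ρ X)                          ∎

  ρ-+span : ∀ {t} W (us : Vec (V n) t) → ρ (W +span us) ≤ ρ W +ℕ t
  ρ-+span W []       = ℕₚ.m≤m+n (ρ W) 0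
  ρ-+span W (u ∷ us) = ℕₚ.≤-trans (ρ-+⟨⟩ (W +span us) u)
                                  (ℕₚ.≤-trans (s≤s (ρ-+span W us)) (ℕₚ.≤-reflexive (sym (ℕₚ.+-suc _ _))))

  ρE≤dim+ρ-perp : ∀ {Y W d} → IsDim 𝔽 n Y d → IsPerp 𝔽 n Y W → ρE ≤ d +ℕ ρ W
  ρE≤dim+ρ-perp {Y} {W} {d} (ys , basis) Y⊥W
    with t , us , t≤d , spanning ← complement-spans Y ys basis W Y⊥W = begin
    ρE               ≤⟨ ρ-mono (full 𝔽 n) (W +span us) (λ v _ → InSpanMod→+span W us v (spanning v)) ⟩
    ρ (W +span us)   ≤⟨ ρ-+span W us ⟩
    ρ W +ℕ t         ≤⟨ ℕₚ.+-monoʳ-≤ (ρ W) t≤d ⟩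
    ρ W +ℕ d         ≡⟨ ℕₚ.+-comm (ρ W) d ⟩
    d +ℕ ρ W         ∎

  ρ-perp-unique : ∀ Z P Q → IsPerp 𝔽 n Z P → IsPerp 𝔽 n Z Q → ρ P ≡ ρ Q
  ρ-perp-unique Z P Q Z⊥P Z⊥Q =
    ℕₚ.≤-antisym (ρ-mono P Q (perp-unique Z P Q Z⊥P Z⊥Q)) (ρ-mono Q P (perp-unique Z Q P Z⊥Q Z⊥P))

  DualNullity⇔ : ∀ Z P {i} → IsPerp 𝔽 n Z P → DualNullity 𝔽 n M Z i ⇔ ρE ∸ ρ P ≡ i
  DualNullity⇔ Z P Z⊥P = mk⇔
    (λ η → let d , dim = dimension Z in trans (sym (nullity dim Z⊥P)) (η d P dim Z⊥P))
    (λ ρE∸ρP≡i d Y dim Z⊥Y →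
       trans (nullity dim Z⊥Y) (trans (cong (ρE ∸_) (ρ-perp-unique Z Y P Z⊥Y Z⊥P)) ρE∸ρP≡i))
    where
    nullity : ∀ {d Y} → IsDim 𝔽 n Z d → IsPerp 𝔽 n Z Y → d ∸ dualRank 𝔽 n M d Y ≡ ρE ∸ ρ Y
    nullity {d} {Y} dim Z⊥Y = m∸[m+n∸o]≡o∸n d (ρ Y) ρE (ρE≤dim+ρ-perp dim Z⊥Y)

  perp-DualNullity⇔ : ∀ X Y {r} → IsPerp 𝔽 n X Y → r ≤ ρE → DualNullity 𝔽 n M Y (ρE ∸ r) ⇔ ρ X ≡ r
  perp-DualNullity⇔ X Y X⊥Y r≤ρE = mk⇔
    (λ η → ℕₚ.∸-cancelˡ-≡ (ρ≤ρE X) r≤ρE (Equivalence.to (DualNullity⇔ Y X Y⊥X) η))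
    (λ ρX≡r → Equivalence.from (DualNullity⇔ Y X Y⊥X) (cong (ρE ∸_) ρX≡r))
    where
    Y⊥X = perp-sym X Y X⊥Y

  Closed : Subspace 𝔽 n → Set₁
  Closed X = ∀ S → X ⊆ˢ S → ρ S ≤ ρ X → S ⊆ˢ X

  flat⇒closed : ∀ X → IsFlat 𝔽 n M X → Closed X
  flat⇒closed X flat S X⊆S ρS≤ρX v v∈S with Subspace.mem? X v
  ... | yes v∈X = v∈X
  ... | no v∉X  = ⊥-elim (ℕₚ.<⇒≱ (flat v v∉X (X +⟨ v ⟩) (+⟨⟩-IsSumSpan X v))
                                 (ℕₚ.≤-trans (ρ-mono (X +⟨ v ⟩) S X+v⊆S) ρS≤ρX))
    where
    X+v⊆S : X +⟨ v ⟩ ⊆ˢ S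
    X+v⊆S _ (x , c , x∈X , refl) = Subspace.mem-+ S (X⊆S x x∈X) (Subspace.mem-· S c v∈S)

  closed⇒flat : ∀ X → Closed X → IsFlat 𝔽 n M X
  closed⇒flat X closed e e∉X S S≡X+e with ρ X ℕₚ.<? ρ S
  ... | yes ρX<ρS = ρX<ρS
  ... | no ρX≮ρS  = ⊥-elim (e∉X (closed S X⊆S (ℕₚ.≮⇒≥ ρX≮ρS) e e∈S))
    where
    X⊆S : X ⊆ˢ S
    X⊆S x x∈X = Equivalence.from (S≡X+e x)
                  (x , 0# , x∈X , sym (trans (cong (x ⊞_) (⊡-zeroˡ e)) (⊞-identityʳ x)))
    e∈S : S ∋ e
    e∈S = Equivalence.from (S≡X+e e)
            (𝟎 , 1# , Subspace.mem-0 X , sym (trans (⊞-identityˡ _) (⊡-identityˡ e)))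

  closed⇒perp-minimal : ∀ X Y → Closed X → IsPerp 𝔽 n X Y →
                        ∀ Z → Z ⊆ˢ Y → DualNullity 𝔽 n M Z (ρE ∸ ρ X) → Y ⊆ˢ Z
  closed⇒perp-minimal X Y closed X⊥Y Z Z⊆Y η = perp-antitone P X Z Y P⊆X (perp-sym Z P Z⊥P) X⊥Y
    where
    P = proj₁ (perp Z)
    Z⊥P = proj₂ (perp Z)
    X⊆P : X ⊆ˢ P
    X⊆P = perp-antitone Z Y P X Z⊆Y Z⊥P (perp-sym X Y X⊥Y)
    ρP≡ρX : ρ P ≡ ρ X
    ρP≡ρX = ℕₚ.∸-cancelˡ-≡ (ρ≤ρE P) (ρ≤ρE X) (Equivalence.to (DualNullity⇔ Z P Z⊥P) η)
    P⊆X : P ⊆ˢ X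
    P⊆X = closed P X⊆P (ℕₚ.≤-reflexive ρP≡ρX)

  perp-dualCycle⇒closed : ∀ X Y {r} → IsPerp 𝔽 n X Y → IsDualCycle 𝔽 n M Y (ρE ∸ r) →
                          ρ X ≡ r → Closed X
  perp-dualCycle⇒closed X Y {r} X⊥Y (_ , minimal) ρX≡r S X⊆S ρS≤ρX =
    perp-antitone Y Z X S Y⊆Z (perp-sym X Y X⊥Y) (perp-sym S Z S⊥Z)
    where
    Z = proj₁ (perp S)
    S⊥Z = proj₂ (perp S)
    η : DualNullity 𝔽 n M Z (ρE ∸ r)
    η = Equivalence.from (DualNullity⇔ Z S (perp-sym S Z S⊥Z))
                         (cong (ρE ∸_) (trans (ℕₚ.≤-antisym ρS≤ρX (ρ-mono X S X⊆S)) ρX≡r))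
    Y⊆Z : Y ⊆ˢ Z
    Y⊆Z = minimal Z (perp-antitone X S Y Z X⊆S X⊥Y S⊥Z) η

lemma2p13 : (𝔽 : FiniteField) (n : ℕ) (M : QMatroid 𝔽 n)
            (X Xperp : Subspace 𝔽 n) (r : ℕ) →
            IsPerp 𝔽 n X Xperp →
            (IsFlat 𝔽 n M X × QMatroid.ρ M X ≡ r)
              ⇔ (r ≤ QMatroid.ρ M (full 𝔽 n) × IsDualCycle 𝔽 n M Xperp (QMatroid.ρ M (full 𝔽 n) ∸ r))
lemma2p13 𝔽 n M X Xperp r X⊥Xperp = mk⇔
  (λ { (flat , refl) →
       ρ≤ρE X ,
       Equivalence.from (nullity (ρ≤ρE X)) refl ,
       closed⇒perp-minimal X Xperp (flat⇒closed X flat) X⊥Xperp })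
  (λ { (r≤ρE , cycle@(η , _)) →
       let ρX≡r = Equivalence.to (nullity r≤ρE) η
       in closed⇒flat X (perp-dualCycle⇒closed X Xperp X⊥Xperp cycle ρX≡r) , ρX≡r })
  where
  open Duality 𝔽 M
  nullity : ∀ {r} → r ≤ ρE → DualNullity 𝔽 n M Xperp (ρE ∸ r) ⇔ QMatroid.ρ M X ≡ r
  nullity = perp-DualNullity⇔ X Xperp X⊥Xperp
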